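{- Let $H$ be a graph with $\ell:=\chi(H)\ge 2$ and let $k\in\mathbb{N}$. Let $G_1$ be a complete $\ell$-partite graph of order $k|H|$ whose vertex classes $U_1,\dots,U_\ell$ satisfy $|U_1|=\lfloor k|H|/\ell\rfloor+1$, $|U_2|=\lceil k|H|/\ell\rceil-1$ and $\lfloor k|H|/\ell\rfloor\le |U_i|\le\lceil k|H|/\ell\rceil$ for all $i\ge 3$. If either $\ell\ge 3$ and ${\rm hcf}_\chi(H)\ne 1$, or $\ell=2$ and ${\rm hcf}_\chi(H)\ge 3$, then $G_1$ does not contain a perfect $H$-packing.
   Context: An optimal colouring of $H$ is a proper colouring using exactly $\chi(H)$ colours. For an optimal colouring $c$ with colour class sizes $x_1\le\dots\le x_\ell$, $\mathcal{D}(c):=\{x_{i+1}-x_i:1\le i\le\ell-1\}$; $\mathcal{D}(H)$ is the union of all $\mathcal{D}(c)$ over optimal colourings; ${\rm hcf}_\chi(H)$ is the highest common factor of the integers in $\mathcal{D}(H)$, with ${\rm hcf}_\chi(H):=\infty$ if $\mathcal{D}(H)=\{0\}$ (so $\infty\ge 3$ and $\infty\neq 1$). A perfect $H$-packing in $G$ is a collection of vertex-disjoint copies of $H$ in $G$ covering all vertices of $G$. -}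

module Defs where

open import Data.Nat using (ℕ; zero; suc; _+_; _*_; _∸_; _≤_; _<_; NonZero)
open import Data.Nat.DivMod using (_/_)
open import Data.Nat.Divisibility using (_∣_)
open import Data.Nat.Properties using (≤-decTotalOrder)
open import Data.Fin using (Fin; _≟_)
open import Data.List using (List; []; _∷_; length; filter; map; allFin)
open import Data.List.Membership.Propositional using (_∈_)
open import Data.List.Sort ≤-decTotalOrder using (sort)
open import Data.Product using (Σ; ∃; _×_; _,_)
open import Data.Sum using (_⊎_)
open import Relation.Nullary using (¬_)
open import Relation.Binary.PropositionalEquality using (_≡_; _≢_; refl; sym)

record Graph : Set₁ where
  field
    n     : ℕ
    Adj   : Fin n → Fin n → Set
    Adj-sym : ∀ {u v} → Adj u v → Adj v u
    irrefl : ∀ {v} → ¬ Adj v v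

open Graph public

count : ∀ {N ℓ} → (Fin N → Fin ℓ) → Fin ℓ → ℕ
count {N} p i = length (filter (λ v → p v ≟ i) (allFin N))

Proper : (H : Graph) {c : ℕ} → (Fin (n H) → Fin c) → Set
Proper H f = ∀ {u v} → Adj H u v → f u ≢ f v

Colourable : Graph → ℕ → Set
Colourable H c = Σ (Fin (n H) → Fin c) (Proper H)

IsChromaticNumber : Graph → ℕ → Set
IsChromaticNumber H ℓ = Colourable H ℓ × (∀ j → j < ℓ → ¬ Colourable H j)

diffs : List ℕ → List ℕ
diffs (x ∷ y ∷ xs) = (y ∸ x) ∷ diffs (y ∷ xs)
diffs _ = []

classSizes : ∀ {N ℓ} → (Fin N → Fin ℓ) → List ℕ
classSizes {ℓ = ℓ} f = sort (map (count f) (allFin ℓ))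

Dc : ∀ {N ℓ} → (Fin N → Fin ℓ) → List ℕ
Dc f = diffs (classSizes f)

InD : Graph → ℕ → Set
InD H d = ∃ λ ℓ → IsChromaticNumber H ℓ ×
            Σ (Fin (n H) → Fin ℓ) (λ f → Proper H f × d ∈ Dc f)

data ℕ∞ : Set where
  fin : ℕ → ℕ∞
  ∞   : ℕ∞

IsHcfOf : (ℕ → Set) → ℕ → Set
IsHcfOf P g = (∀ d → P d → g ∣ d) × (∀ e → (∀ d → P d → e ∣ d) → e ∣ g)

IsHcfχ : Graph → ℕ∞ → Set
IsHcfχ H h =
  (h ≡ ∞ × (∀ d → InD H d → d ≡ 0)) ⊎
  (∃ λ g → h ≡ fin g × ¬ (∀ d → InD H d → d ≡ 0) × IsHcfOf (InD H) g)

_≥3 : ℕ∞ → Set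
h ≥3 = h ≡ ∞ ⊎ (∃ λ g → h ≡ fin g × 3 ≤ g)

completeMultipartite : (N ℓ : ℕ) → (Fin N → Fin ℓ) → Graph
completeMultipartite N ℓ p = record
  { n = N
  ; Adj = λ u v → p u ≢ p v
  ; Adj-sym = λ h e → h (sym e)
  ; irrefl = λ h → h refl
  }

⌈_/_⌉ : ℕ → (d : ℕ) → .{{NonZero d}} → ℕ
⌈ m / d ⌉ = (m + d ∸ 1) / d

record Copy (H G : Graph) : Set where
  field
    emb : Fin (n H) → Fin (n G)
    inj : ∀ {x y} → emb x ≡ emb y → x ≡ y
    hom : ∀ {x y} → Adj H x y → Adj G (emb x) (emb y)

open Copy public

PerfectPacking : Graph → Graph → Set
PerfectPacking H G = ∃ λ t → Σ (Fin t → Copy H G) λ φ →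
  (∀ v → ∃ λ j → ∃ λ x → emb (φ j) x ≡ v) ×
  (∀ j j' x x' → emb (φ j) x ≡ emb (φ j') x' → j ≡ j' × x ≡ x')

{-# OPTIONS --safe #-}
module Submission where

-- Let g be a common divisor of the integers in D(H). Sorting the colour classes of an optimal
-- colouring, consecutive sizes differ by multiples of g, so all class sizes are congruent
-- modulo g. Every copy of H in a perfect packing of G₁ is coloured optimally by the vertex
-- classes of G₁, and each |Uᵢ| is a sum over the copies of one class size of each, so the
-- |Uᵢ| are pairwise congruent modulo g as well. If ⌈k|H|/ℓ⌉ = ⌊k|H|/ℓ⌋ + 1, then
-- |U₁| − |U₂| = 1; otherwise |U₁| − |U₂| = 2 and |Uᵢ| = |U₁| − 1 for i ≥ 3. Hence g ∣ 2, and
-- g ∣ 1 when ℓ ≥ 3. Applied to g = hcf_χ(H), or to g = 0 when D(H) = {0}, this contradicts the hypothesis.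

open import Defs
open import Function using (_∘_)
open import Function.Bundles using (mk⇔)
open import Data.Nat using (ℕ; zero; suc; _+_; _*_; _∸_; _≤_; s≤s)
open import Data.Nat.Properties
  using (+-identityʳ; +-assoc; +-suc; +-cancelˡ-≡; m+[n∸m]≡n; m+n∸n≡m; m≤m+n; m≤n+m; m∸n≤m;
         ≤-trans; ≤-reflexive; ≤-decTotalOrder; ≤-antisym; m≤n⇒m<n∨m≡n; <⇒≱)
open import Data.Nat.DivMod using (_/_; /-monoˡ-≤; m/n≡1+[m∸n]/n)
open import Data.Nat.Divisibility using (_∣_; divides; n∣m*n; ∣m+n∣m⇒∣n; ∣-trans; 1∣_; _∣0; ∣1⇒≡1; ∣⇒≤; 0∣⇒≡0)
open import Data.Nat.Tactic.RingSolver using (solve-∀)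
open import Data.Fin using (Fin; zero; suc; _≟_; fromℕ<)
open import Data.List using (List; []; _∷_; _++_; length; filter; map; allFin; cartesianProductWith)
open import Data.List.Properties using (length-++; filter-++)
open import Data.List.Membership.Propositional using (_∈_)
open import Data.List.Membership.Propositional.Properties using (∈-map⁺; ∈-allFin; ∈-cartesianProductWith⁺)
open import Data.List.Membership.Propositional.Properties.WithK using (unique∧set⇒bag)
open import Data.List.Relation.Unary.Any using (here; there)
open import Data.List.Relation.Unary.Linked using (Linked; _∷_)
open import Data.List.Relation.Unary.Unique.Propositional.Properties using (allFin⁺; cartesianProductWith⁺)
open import Data.List.Relation.Binary.BagAndSetEquality using (∼bag⇒↭)
open import Data.List.Relation.Binary.Permutation.Propositional using (_↭_; ↭-sym)
open import Data.List.Relation.Binary.Permutation.Propositional.Properties using (∈-resp-↭; filter-↭; ↭-length)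
open import Data.List.Sort ≤-decTotalOrder using (sort-↗; sort-↭)
open import Data.Product using (_×_; _,_; ∃)
open import Data.Sum using (_⊎_; inj₁; inj₂)
open import Data.Empty using (⊥)
open import Relation.Nullary using (¬_; yes; no)
open import Relation.Binary.PropositionalEquality using (_≡_; _≢_; refl; sym; trans; cong; subst)
open Relation.Binary.PropositionalEquality.≡-Reasoning

infix 4 _≤≡_[mod_]

-- r ≤ x and x ≡ r (mod g), stated without _%_ so that g = 0 is allowed
_≤≡_[mod_] : ℕ → ℕ → ℕ → Set
r ≤≡ x [mod g ] = ∃ λ y → x ≡ r + y * g

≤≡-refl : ∀ {g r} → r ≤≡ r [mod g ]
≤≡-refl {r = r} = 0 , sym (+-identityʳ r)

≤≡-trans : ∀ {g r s x} → r ≤≡ s [mod g ] → s ≤≡ x [mod g ] → r ≤≡ x [mod g ]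
≤≡-trans {g} {r} (y , refl) (z , refl) = y + z , regroup r y z g
  where
  regroup : ∀ r y z g → r + y * g + z * g ≡ r + (y + z) * g
  regroup = solve-∀

≤≡-+ : ∀ {g r s x y} → r ≤≡ x [mod g ] → s ≤≡ y [mod g ] → r + s ≤≡ x + y [mod g ]
≤≡-+ {g} {r} {s} (a , refl) (b , refl) = a + b , regroup r s a b g
  where
  regroup : ∀ r s a b g → r + a * g + (s + b * g) ≡ r + s + (a + b) * g
  regroup = solve-∀

≤≡-∣ : ∀ {g r x d} → r ≤≡ x [mod g ] → r ≤≡ x + d [mod g ] → g ∣ d
≤≡-∣ {g} {r} {d = d} (a , refl) (b , r+ag+d≡r+bg) =
  ∣m+n∣m⇒∣n (subst (g ∣_) bg≡ag+d (n∣m*n b)) (n∣m*n a)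
  where
  bg≡ag+d : b * g ≡ a * g + d
  bg≡ag+d = +-cancelˡ-≡ r (b * g) (a * g + d) (trans (sym r+ag+d≡r+bg) (+-assoc r (a * g) d))

≤∧∣∸⇒≤≡ : ∀ {g x y} → x ≤ y → g ∣ y ∸ x → x ≤≡ y [mod g ]
≤∧∣∸⇒≤≡ {x = x} x≤y (divides w y∸x≡wg) = w , trans (sym (m+[n∸m]≡n x≤y)) (cong (x +_) y∸x≡wg)

CommonResidue : ∀ {A : Set} → ℕ → (A → ℕ) → Set
CommonResidue g c = ∃ λ r → ∀ i → r ≤≡ c i [mod g ]

CommonResidue-resp : ∀ {A : Set} {g} {c c′ : A → ℕ} →
  (∀ i → c i ≡ c′ i) → CommonResidue g c → CommonResidue g c′
CommonResidue-resp c≡c′ (r , r≤≡c) = r , λ i → subst (_ ≤≡_[mod _ ]) (c≡c′ i) (r≤≡c i)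

CommonResidue-+ : ∀ {A : Set} {g} {c c′ : A → ℕ} →
  CommonResidue g c → CommonResidue g c′ → CommonResidue g (λ i → c i + c′ i)
CommonResidue-+ (r , r≤≡c) (r′ , r′≤≡c′) = r + r′ , λ i → ≤≡-+ (r≤≡c i) (r′≤≡c′ i)

sorted∧∣diffs⇒≤≡head : ∀ {g x xs} → Linked _≤_ (x ∷ xs) → (∀ {d} → d ∈ diffs (x ∷ xs) → g ∣ d) →
  ∀ {a} → a ∈ x ∷ xs → x ≤≡ a [mod g ]
sorted∧∣diffs⇒≤≡head _ _ (here refl) = ≤≡-refl
sorted∧∣diffs⇒≤≡head {xs = y ∷ ys} (x≤y ∷ sorted) g∣diffs (there a∈y∷ys) =
  ≤≡-trans (≤∧∣∸⇒≤≡ x≤y (g∣diffs (here refl))) (sorted∧∣diffs⇒≤≡head sorted (g∣diffs ∘ there) a∈y∷ys)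

sorted∧∣diffs⇒commonResidue : ∀ {g xs} → Linked _≤_ xs → (∀ {d} → d ∈ diffs xs → g ∣ d) →
  ∃ λ r → ∀ {a} → a ∈ xs → r ≤≡ a [mod g ]
sorted∧∣diffs⇒commonResidue {xs = []} _ _ = 0 , λ ()
sorted∧∣diffs⇒commonResidue {xs = x ∷ xs} sorted g∣diffs = x , sorted∧∣diffs⇒≤≡head sorted g∣diffs

infix 4 _∣ᴰ_

_∣ᴰ_ : ℕ → Graph → Set
g ∣ᴰ H = ∀ d → InD H d → g ∣ d

count∈classSizes : ∀ {N ℓ} (f : Fin N → Fin ℓ) i → count f i ∈ classSizes f
count∈classSizes f i = ∈-resp-↭ (↭-sym (sort-↭ _)) (∈-map⁺ (count f) (∈-allFin i))

optimal⇒commonResidue : ∀ {H ℓ g} → IsChromaticNumber H ℓ → g ∣ᴰ H →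
  (f : Fin (n H) → Fin ℓ) → Proper H f → CommonResidue g (count f)
optimal⇒commonResidue {ℓ = ℓ} χ g∣D f proper =
  let r , r≤≡ = sorted∧∣diffs⇒commonResidue (sort-↗ _) (λ {d} d∈Dc → g∣D d (ℓ , χ , f , proper , d∈Dc))
  in r , λ i → r≤≡ (count∈classSizes f i)

countIn : ∀ {N ℓ} → (Fin N → Fin ℓ) → Fin ℓ → List (Fin N) → ℕ
countIn p i vs = length (filter (λ v → p v ≟ i) vs)

countIn-++ : ∀ {N ℓ} (p : Fin N → Fin ℓ) i us vs →
  countIn p i (us ++ vs) ≡ countIn p i us + countIn p i vs
countIn-++ p i us vs =
  trans (cong length (filter-++ (λ v → p v ≟ i) us vs)) (length-++ (filter (λ v → p v ≟ i) us))

countIn-map : ∀ {M N ℓ} (p : Fin N → Fin ℓ) (f : Fin M → Fin N) i vs →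
  countIn p i (map f vs) ≡ countIn (p ∘ f) i vs
countIn-map p f i [] = refl
countIn-map p f i (v ∷ vs) with p (f v) ≟ i
... | yes _ = cong suc (countIn-map p f i vs)
... | no _ = countIn-map p f i vs

countIn-↭ : ∀ {N ℓ} (p : Fin N → Fin ℓ) i {us vs} → us ↭ vs → countIn p i us ≡ countIn p i vs
countIn-↭ p i us↭vs = ↭-length (filter-↭ (λ v → p v ≟ i) us↭vs)

module _ {H G : Graph} {t : ℕ} (φ : Fin t → Copy H G) where

  verticesOf : List (Fin t) → List (Fin (n G))
  verticesOf js = cartesianProductWith (λ j → emb (φ j)) js (allFin (n H))

  covering∧disjoint⇒verticesOf↭allFin : (∀ v → ∃ λ j → ∃ λ x → emb (φ j) x ≡ v) →
    (∀ j j′ x x′ → emb (φ j) x ≡ emb (φ j′) x′ → j ≡ j′ × x ≡ x′) →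
    verticesOf (allFin t) ↭ allFin (n G)
  covering∧disjoint⇒verticesOf↭allFin covering disjoint = ∼bag⇒↭ (unique∧set⇒bag
    (cartesianProductWith⁺ _ (disjoint _ _ _ _) (allFin⁺ t) (allFin⁺ (n H)))
    (allFin⁺ (n G))
    (mk⇔ (λ _ → ∈-allFin _) covered))
    where
    covered : ∀ {v} → v ∈ allFin (n G) → v ∈ verticesOf (allFin t)
    covered {v} _ with covering v
    ... | j , x , refl = ∈-cartesianProductWith⁺ _ (∈-allFin j) (∈-allFin x)

perfectPacking⇒commonResidue : ∀ {H N ℓ g} → IsChromaticNumber H ℓ → g ∣ᴰ H → (p : Fin N → Fin ℓ) →
  PerfectPacking H (completeMultipartite N ℓ p) → CommonResidue g (count p)
perfectPacking⇒commonResidue {H} {g = g} χ g∣D p (t , φ , covering , disjoint) =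
  CommonResidue-resp (λ i → countIn-↭ p i (covering∧disjoint⇒verticesOf↭allFin φ covering disjoint))
                     (copies (allFin t))
  where
  countIn-copy : ∀ j js i →
    count (p ∘ emb (φ j)) i + countIn p i (verticesOf φ js) ≡ countIn p i (verticesOf φ (j ∷ js))
  countIn-copy j js i = begin
    count (p ∘ emb (φ j)) i + countIn p i (verticesOf φ js)
      ≡⟨ cong (_+ _) (countIn-map p (emb (φ j)) i (allFin (n H))) ⟨
    countIn p i (map (emb (φ j)) (allFin (n H))) + countIn p i (verticesOf φ js)
      ≡⟨ countIn-++ p i (map (emb (φ j)) (allFin (n H))) (verticesOf φ js) ⟨
    countIn p i (verticesOf φ (j ∷ js)) ∎

  copies : ∀ js → CommonResidue g (λ i → countIn p i (verticesOf φ js))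
  copies [] = 0 , λ _ → ≤≡-refl
  copies (j ∷ js) = CommonResidue-resp (countIn-copy j js)
    (CommonResidue-+ (optimal⇒commonResidue {H} χ g∣D (p ∘ emb (φ j)) (hom (φ j))) (copies js))

m≤n≤1+m⇒n≡m⊎n≡1+m : ∀ {m n} → m ≤ n → n ≤ suc m → n ≡ m ⊎ n ≡ suc m
m≤n≤1+m⇒n≡m⊎n≡1+m m≤n n≤1+m with m≤n⇒m<n∨m≡n n≤1+m
... | inj₁ (s≤s n≤m) = inj₁ (≤-antisym n≤m m≤n)
... | inj₂ n≡1+m = inj₂ n≡1+m

⌈m/n⌉≡m/n⊎1+m/n : ∀ m n → ⌈ m / suc n ⌉ ≡ m / suc n ⊎ ⌈ m / suc n ⌉ ≡ suc (m / suc n)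
⌈m/n⌉≡m/n⊎1+m/n m n = m≤n≤1+m⇒n≡m⊎n≡1+m
  (/-monoˡ-≤ (suc n) (subst (m ≤_) (sym (cong (_∸ 1) (+-suc m n))) (m≤m+n m n)))
  (≤-trans (/-monoˡ-≤ (suc n) (m∸n≤m (m + suc n) 1)) (≤-reflexive [m+n]/n≡1+m/n))
  where
  [m+n]/n≡1+m/n : (m + suc n) / suc n ≡ suc (m / suc n)
  [m+n]/n≡1+m/n = trans (m/n≡1+[m∸n]/n (m≤n+m (suc n) m)) (cong (λ k → suc (k / suc n)) (m+n∸n≡m m (suc n)))

≤≡-q+1-c∸1⇒∣2 : ∀ {g r} q c → c ≡ q ⊎ c ≡ suc q → r ≤≡ q + 1 [mod g ] → r ≤≡ c ∸ 1 [mod g ] → g ∣ 2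
≤≡-q+1-c∸1⇒∣2 q _ (inj₂ refl) r≤≡q+1 r≤≡q = ∣-trans (≤≡-∣ r≤≡q r≤≡q+1) (1∣ 2)
≤≡-q+1-c∸1⇒∣2 zero _ (inj₁ refl) r≤≡1 r≤≡0 = ∣-trans (≤≡-∣ r≤≡0 r≤≡1) (1∣ 2)
≤≡-q+1-c∸1⇒∣2 {g} {r} (suc q) _ (inj₁ refl) r≤≡q+2 r≤≡q =
  ≤≡-∣ r≤≡q (subst (r ≤≡_[mod g ]) (sym (+-suc q 1)) r≤≡q+2)

≤≡-q+1-c∸1-x⇒∣1 : ∀ {g r x} q c → c ≡ q ⊎ c ≡ suc q → r ≤≡ q + 1 [mod g ] → r ≤≡ c ∸ 1 [mod g ] →
  q ≤ x → x ≤ c → r ≤≡ x [mod g ] → g ∣ 1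
≤≡-q+1-c∸1-x⇒∣1 q _ (inj₂ refl) r≤≡q+1 r≤≡q _ _ _ = ≤≡-∣ r≤≡q r≤≡q+1
≤≡-q+1-c∸1-x⇒∣1 q _ (inj₁ refl) r≤≡q+1 _ q≤x x≤q r≤≡x rewrite ≤-antisym x≤q q≤x = ≤≡-∣ r≤≡x r≤≡q+1

0∤2 : ¬ 0 ∣ 2
0∤2 0∣2 with () ← 0∣⇒≡0 0∣2

hcfχ-hypothesis⇒divisor : ∀ {H h m} → IsHcfχ H h → (1 ≤ m × h ≢ fin 1) ⊎ (m ≡ 0 × h ≥3) →
  ∃ λ g → g ∣ᴰ H × (¬ g ∣ 2 ⊎ (1 ≤ m × ¬ g ∣ 1))
hcfχ-hypothesis⇒divisor (inj₁ (_ , D≡0)) _ = 0 , (λ d d∈D → subst (0 ∣_) (sym (D≡0 d d∈D)) (0 ∣0)) , inj₁ 0∤2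
hcfχ-hypothesis⇒divisor (inj₂ (g , refl , _ , g∣D , _)) (inj₁ (1≤m , h≢1)) =
  g , g∣D , inj₂ (1≤m , λ g∣1 → h≢1 (cong fin (∣1⇒≡1 g∣1)))
hcfχ-hypothesis⇒divisor (inj₂ (g , refl , _ , g∣D , _)) (inj₂ (_ , inj₂ (_ , refl , 3≤g))) =
  g , g∣D , inj₁ (λ g∣2 → <⇒≱ 3≤g (∣⇒≤ g∣2))

proposition6 : (H : Graph) (m k : ℕ) → IsChromaticNumber H (suc (suc m))
    → (p : Fin (k * n H) → Fin (suc (suc m)))
    → count p zero ≡ (k * n H) / suc (suc m) + 1
    → count p (suc zero) ≡ ⌈ k * n H / suc (suc m) ⌉ ∸ 1
    → (∀ (i : Fin m) → ((k * n H) / suc (suc m) ≤ count p (suc (suc i)))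
                      × (count p (suc (suc i)) ≤ ⌈ k * n H / suc (suc m) ⌉))
    → (h : ℕ∞) → IsHcfχ H h
    → ((1 ≤ m × h ≢ fin 1) ⊎ (m ≡ 0 × h ≥3))
    → ¬ PerfectPacking H (completeMultipartite (k * n H) (suc (suc m)) p)
proposition6 H m k χ p |U₁| |U₂| |Uᵢ| h hcf hypothesis packing
  with hcfχ-hypothesis⇒divisor {H} hcf hypothesis
... | g , g∣D , g∤ with perfectPacking⇒commonResidue {H} χ g∣D p packing
... | r , r≤≡|U| = excluded g∤
  where
  q c : ℕ
  q = k * n H / suc (suc m)
  c = ⌈ k * n H / suc (suc m) ⌉

  r≤≡q+1 : r ≤≡ q + 1 [mod g ]
  r≤≡q+1 = subst (r ≤≡_[mod g ]) |U₁| (r≤≡|U| zero)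

  r≤≡c∸1 : r ≤≡ c ∸ 1 [mod g ]
  r≤≡c∸1 = subst (r ≤≡_[mod g ]) |U₂| (r≤≡|U| (suc zero))

  c≡q⊎1+q : c ≡ q ⊎ c ≡ suc q
  c≡q⊎1+q = ⌈m/n⌉≡m/n⊎1+m/n (k * n H) (suc m)

  excluded : ¬ g ∣ 2 ⊎ (1 ≤ m × ¬ g ∣ 1) → ⊥
  excluded (inj₁ g∤2) = g∤2 (≤≡-q+1-c∸1⇒∣2 q c c≡q⊎1+q r≤≡q+1 r≤≡c∸1)
  excluded (inj₂ (1≤m , g∤1)) with |Uᵢ| (fromℕ< 1≤m)
  ... | q≤|U₃| , |U₃|≤c =
    g∤1 (≤≡-q+1-c∸1-x⇒∣1 q c c≡q⊎1+q r≤≡q+1 r≤≡c∸1 q≤|U₃| |U₃|≤c (r≤≡|U| (suc (suc (fromℕ< 1≤m)))))
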